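{- Let $G$ be a graph with a normal spanning tree $T$, and suppose the vertices of $G$ are numbered with a numbering compatible with $T$. Let $T[a,b]$ be a leftmost path in $T$ with $a<b$. Then $T[a,b]$ is stable if and only if $witn(v)\ge a$ for every $v\in T(a,b)$.
   Context: $T$ is rooted; $T[u,v]$ is the $u$–$v$ path in $T$ and $T(u,v)$ that path without $u,v$; $ND(v)$ number of descendants; normal: endpoints of every edge of $G$ comparable; back-edges are non-tree edges $(x,y)$ with $x$ a descendant of $y$. $L(v)$: proper ancestors of $v$ adjacent to some descendant of $v$ (including $v$); $lwpt_k(v)$: $k$-th element of $L(v)$ closest to the root if $|L(v)|\ge k$, else $v$; $lwpt=lwpt_1$. Vertices are $[n]$; compatible numbering: descendants of each $j$ form $[j,j+ND(j)-1]$ and siblings $j<k$ satisfy $(-lwpt_1(j),lwpt_2(j))\le_{lex}(-lwpt_1(k),lwpt_2(k))$. Left child = largest child; leftmost descendant = reached by repeatedly taking left children (zero or more times). If $a'$ is a child of $a$ and $b$ a leftmost descendant of $a'$ then $T[a,b]$ is a leftmost path, and (for $a<b$) it is stable if every back-edge $(x,y)$ with $a'\le x<b$ satisfies $y\ge a$. $N_{\min}(v)$ is the smallest neighbour of $v$ in $G$. If $v$ has at least two children and $w$ is its second largest child, $witn(v)=\min(N_{\min}(v),lwpt(w))$; otherwise $witn(v)=N_{\min}(v)$. -}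

module Defs where

open import Data.Nat using (ℕ; zero; suc; _≤_; _<_; _⊓_)
open import Data.Product using (Σ; ∃; _×_; _,_)
open import Data.Sum using (_⊎_)
open import Relation.Nullary using (¬_; Dec)
open import Relation.Binary.PropositionalEquality using (_≡_; _≢_)

InV : ℕ → ℕ → Set
InV n v = 1 ≤ v × v ≤ n

record Graph (n : ℕ) : Set₁ where
  field
    Adj      : ℕ → ℕ → Set
    adj-dec  : ∀ u v → Dec (Adj u v)
    adj-sym  : ∀ {u v} → Adj u v → Adj v u
    adj-irr  : ∀ {u} → ¬ Adj u u
    adj-inV  : ∀ {u v} → Adj u v → InV n u
open Graph public

iter : (ℕ → ℕ) → ℕ → ℕ → ℕ
iter f zero    x = x
iter f (suc k) x = f (iter f k x)

-- Every vertex reaches the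
-- root by iterating the parent map, which makes the structure a tree.
record SpanningTree {n : ℕ} (G : Graph n) : Set where
  field
    root       : ℕ
    par        : ℕ → ℕ
    root-inV   : InV n root
    par-root   : par root ≡ root
    par-inV    : ∀ v → InV n v → InV n (par v)
    par-edge   : ∀ v → InV n v → v ≢ root → Adj G v (par v)
    reach-root : ∀ v → InV n v → ∃ λ k → iter par k v ≡ root
open SpanningTree public

module _ {n : ℕ} {G : Graph n} (T : SpanningTree G) where

  -- x is a descendant of y (equivalently y is an ancestor of x); reflexive.
  Desc : ℕ → ℕ → Set
  Desc x y = InV n x × ∃ λ k → iter (par T) k x ≡ y

  ProperAnc : ℕ → ℕ → Set
  ProperAnc y x = Desc x y × y ≢ x

  Child : ℕ → ℕ → Set
  Child c v = InV n c × c ≢ root T × par T c ≡ v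

  Normal : Set
  Normal = ∀ x y → Adj G x y → Desc x y ⊎ Desc y x

  -- back-edge (x , y): non-tree edge of G with x a descendant of y
  BackEdge : ℕ → ℕ → Set
  BackEdge x y = Adj G x y × Desc x y × ¬ (x ≢ root T × par T x ≡ y) × ¬ (y ≢ root T × par T y ≡ x)

  InL : ℕ → ℕ → Set
  InL v u = ProperAnc u v × ∃ λ d → Desc d v × Adj G d u

  Lwpt1 : ℕ → ℕ → Set
  Lwpt1 v w =
      (InL v w × (∀ u → InL v u → ¬ ProperAnc u w))
    ⊎ ((∀ u → ¬ InL v u) × w ≡ v)

  -- lwpt₂(v) = w  (second element of L(v) counted from the root)
  Lwpt2 : ℕ → ℕ → Set
  Lwpt2 v w =
      (InL v w × (∃ λ u → InL v u × ProperAnc u w)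
               × (∀ u u' → InL v u → ProperAnc u w → InL v u' → ProperAnc u' w → u ≡ u'))
    ⊎ ((∀ u u' → InL v u → InL v u' → u ≡ u') × w ≡ v)

  -- Compatible numbering (vertices are [n]):
  -- descendants of j form the interval [j, j + ND(j) - 1], and siblings j < k
  -- satisfy (-lwpt₁ j, lwpt₂ j) ≤lex (-lwpt₁ k, lwpt₂ k).
  Compatible : Set
  Compatible =
      (∀ j → InV n j → ∃ λ m → ∀ x → InV n x → (Desc x j → j ≤ x × x < j + m) × (j ≤ x × x < j + m → Desc x j))
    × (∀ p j k → Child j p → Child k p → j < k →
         ∀ l₁ l₂ m₁ m₂ → Lwpt1 j l₁ → Lwpt2 j l₂ → Lwpt1 k m₁ → Lwpt2 k m₂ →
         (m₁ < l₁) ⊎ (l₁ ≡ m₁ × l₂ ≤ m₂))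
    where open import Data.Nat using (_+_)

  -- c is the largest child (left child) of v
  LeftChild : ℕ → ℕ → Set
  LeftChild c v = Child c v × (∀ c' → Child c' v → c' ≤ c)

  data LeftmostDesc : ℕ → ℕ → Set where
    lm-here : ∀ {a} → LeftmostDesc a a
    lm-step : ∀ {a c b} → LeftChild c a → LeftmostDesc c b → LeftmostDesc a b

  -- T[a,b] (with a' the child of a on it) is a leftmost path: LeftmostPath a a' b
  LeftmostPath : ℕ → ℕ → ℕ → Set
  LeftmostPath a a' b = Child a' a × LeftmostDesc a' b

  Stable : ℕ → ℕ → ℕ → Set
  Stable a a' b = ∀ x y → BackEdge x y → a' ≤ x → x < b → a ≤ y

  Internal : ℕ → ℕ → ℕ → Set
  Internal a b v = Desc b v × Desc v a × v ≢ a × v ≢ b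

  Nmin : ℕ → ℕ → Set
  Nmin v u = Adj G v u × (∀ u' → Adj G v u' → u ≤ u')

  SecondChild : ℕ → ℕ → Set
  SecondChild c v = Child c v × (∃ λ c' → Child c' v × c < c')
                  × (∀ c' c'' → Child c' v → c < c' → Child c'' v → c < c'' → c' ≡ c'')

  AtMostOneChild : ℕ → Set
  AtMostOneChild v = ∀ c c' → Child c v → Child c' v → c ≡ c'

  Witn : ℕ → ℕ → Set
  Witn v w = ∃ λ m → Nmin v m ×
      ((∃ λ c → SecondChild c v × ∃ λ l → Lwpt1 c l × w ≡ m ⊓ l)
     ⊎ (AtMostOneChild v × w ≡ m))

{-# OPTIONS --safe #-}
-- The compatible numbering makes the tree order readable from the numbers: the descendants
-- of a vertex form an interval starting at it, and of two siblings the larger one has the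
-- smaller low point.  If T[a,b] is stable, the neighbours of an internal vertex v and the
-- low point of its second child are reached from the region a' ≤ x < b by tree edges or
-- back-edges, hence are at least a.  Conversely, let (x, y) be a back-edge with a' ≤ x < b
-- and y < a, and let t be the last path vertex with t ≤ x, so that x lies in the subtree of t
-- but before its left child.  Either x = t and witn(t) ≤ N_min(t) ≤ y, or x lies below a
-- child c of t other than the left one; then y ∈ L(c), and the second child s of t has
-- lwpt(s) ≤ lwpt(c) ≤ y, so again witn(t) ≤ y < a.
module Submission where

open import Defs
open import Data.Nat using (ℕ; zero; suc; _≤_; _<_; _+_; _⊓_; s≤s; _≤?_; _<?_; _≟_)
open import Data.Nat.Properties
  using ( ≤-trans; ≤-antisym; ≤-reflexive; ≤-total; ≤-pred; <⇒≤; <⇒≢; <⇒≱; ≮⇒≥; ≰⇒>; ≤∧≢⇒<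
        ; <-≤-trans; ≤-<-trans; <-trans; n<1+n; m<n⇒m<1+n; m≤n⇒m<n∨m≡n; m⊓n≤m; m⊓n≤n; ⊓-glb
        ; anyUpTo? )
open import Data.Product using (∃; ∃₂; _×_; _,_; proj₁; proj₂)
open import Data.Sum using (_⊎_; inj₁; inj₂)
open import Data.Empty using (⊥-elim)
open import Function using (_∘_)
open import Function.Bundles using (_⇔_; mk⇔)
open import Relation.Nullary using (¬_; Dec; yes; no)
open import Relation.Nullary.Decidable using (_×-dec_; ¬?; map′)
open import Relation.Unary using (Decidable)
open import Relation.Binary.PropositionalEquality
  using (_≡_; _≢_; refl; sym; trans; cong; subst; ≢-sym)

iter-+ : ∀ (f : ℕ → ℕ) m k x → iter f (m + k) x ≡ iter f m (iter f k x)
iter-+ f zero    k x = refl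
iter-+ f (suc m) k x = cong f (iter-+ f m k x)

iter-suc : ∀ (f : ℕ → ℕ) k x → iter f k (f x) ≡ iter f (suc k) x
iter-suc f zero    x = refl
iter-suc f (suc k) x = cong f (iter-suc f k x)

iter-fixed : ∀ {f : ℕ → ℕ} {x} → f x ≡ x → ∀ k → iter f k x ≡ x
iter-fixed     fx≡x zero    = refl
iter-fixed {f} fx≡x (suc k) = trans (cong f (iter-fixed fx≡x k)) fx≡x

Least : ∀ {p} → (ℕ → Set p) → ℕ → Set p
Least P k = P k × (∀ {j} → P j → k ≤ j)

module _ {p} {P : ℕ → Set p} (P? : Decidable P) where

  least-witness : ∀ N → ∃ (λ k → k < N × P k) → ∃ (Least P)
  least-witness (suc N) (k , k<1+N , Pk) with anyUpTo? P? N
  ... | yes below = least-witness N below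
  ... | no  none  = k , Pk , λ Pj → ≮⇒≥ λ j<k → none (_ , <-≤-trans j<k (≤-pred k<1+N) , Pj)

  least-or-none : ∀ N → (∀ {k} → P k → k < N) → (∀ k → ¬ P k) ⊎ ∃ (Least P)
  least-or-none N bounded with anyUpTo? P? N
  ... | yes some = inj₂ (least-witness N some)
  ... | no  none = inj₁ λ k Pk → none (k , bounded Pk , Pk)

  greatest-witness : ∀ N → ∃ (λ k → k < N × P k) →
                     ∃ λ k → k < N × P k × (∀ {j} → j < N → P j → j ≤ k)
  greatest-witness (suc N) (k , k<1+N , Pk) with P? N
  ... | yes PN = N , n<1+n N , PN , λ j<1+N _ → ≤-pred j<1+N
  ... | no ¬PN =
    let g , g<N , Pg , g-max = greatest-witness N (k , below k<1+N Pk , Pk)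
    in  g , m<n⇒m<1+n g<N , Pg , λ j<1+N Pj → g-max (below j<1+N Pj) Pj
    where
    below : ∀ {j} → j < suc N → P j → j < N
    below j<1+N Pj = ≤∧≢⇒< (≤-pred j<1+N) λ { refl → ¬PN Pj }

module _ {n} {G : Graph n} (T : SpanningTree G) where

  DescendantIntervals : Set
  DescendantIntervals =
    ∀ j → InV n j → ∃ λ m → ∀ x → InV n x →
      (Desc T x j → j ≤ x × x < j + m) × (j ≤ x × x < j + m → Desc T x j)

  SiblingsOrderedByLowpoints : Set
  SiblingsOrderedByLowpoints =
    ∀ p j k → Child T j p → Child T k p → j < k →
    ∀ l₁ l₂ m₁ m₂ → Lwpt1 T j l₁ → Lwpt2 T j l₂ → Lwpt1 T k m₁ → Lwpt2 T k m₂ →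
    (m₁ < l₁) ⊎ (l₁ ≡ m₁ × l₂ ≤ m₂)

  WitnsAtLeast : ℕ → ℕ → Set
  WitnsAtLeast a b = ∀ v → Internal T a b v → ∀ w → Witn T v w → a ≤ w

  inV? : ∀ v → Dec (InV n v)
  inV? v = (1 ≤? v) ×-dec (v ≤? n)

  inV-< : ∀ {v} → InV n v → v < suc n
  inV-< = s≤s ∘ proj₂

  iter-par-inV : ∀ k {x} → InV n x → InV n (iter (par T) k x)
  iter-par-inV zero    ix = ix
  iter-par-inV (suc k) ix = par-inV T _ (iter-par-inV k ix)

  desc-inV : ∀ {x y} → Desc T x y → InV n y
  desc-inV (ix , k , refl) = iter-par-inV k ix

  desc-refl : ∀ {x} → InV n x → Desc T x x
  desc-refl ix = ix , 0 , refl

  desc-trans : ∀ {x y z} → Desc T x y → Desc T y z → Desc T x z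
  desc-trans {x} (ix , k , refl) (_ , l , refl) = ix , l + k , iter-+ (par T) l k x

  desc-par : ∀ {x y} → Desc T x y → y ≢ x → Desc T (par T x) y
  desc-par     (ix , zero  , refl) y≢x = ⊥-elim (y≢x refl)
  desc-par {x} (ix , suc k , refl) _   = par-inV T x ix , k , iter-suc (par T) k x

  par-fixed⇒root : ∀ {x} → InV n x → par T x ≡ x → x ≡ root T
  par-fixed⇒root ix fixed with reach-root T _ ix
  ... | k , reaches = trans (sym (iter-fixed fixed k)) reaches

  child-desc : ∀ {c v} → Child T c v → Desc T c v
  child-desc (ic , _ , pc≡v) = ic , 1 , pc≡v

  child-≢ : ∀ {c v} → Child T c v → c ≢ v
  child-≢ (ic , c≢root , pc≡v) c≡v = c≢root (par-fixed⇒root ic (trans pc≡v (sym c≡v)))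

  child-adj : ∀ {c v} → Child T c v → Adj G v c
  child-adj (ic , c≢root , refl) = adj-sym G (par-edge T _ ic c≢root)

  child? : ∀ c v → Dec (Child T c v)
  child? c v = inV? c ×-dec (¬? (c ≟ root T) ×-dec (par T c ≟ v))

  child-towards : ∀ {x s} → Desc T x s → x ≢ s → ∃ λ c → Child T c s × Desc T x c
  child-towards {x} {s} (ix , k , reaches) x≢s = towards k reaches
    where
    towards : ∀ k → iter (par T) k x ≡ s → ∃ λ c → Child T c s × Desc T x c
    towards zero    refl = ⊥-elim (x≢s refl)
    towards (suc k) reaches with iter (par T) k x ≟ s
    ... | yes reaches′ = towards k reaches′
    ... | no c≢s = iter (par T) k x , (iter-par-inV k ix , c≢root , reaches) , (ix , k , refl)
      where
      c≢root : iter (par T) k x ≢ root T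
      c≢root c≡root =
        c≢s (trans c≡root (trans (sym (par-root T)) (trans (cong (par T) (sym c≡root)) reaches)))

  leftmost-desc : ∀ {s b} → LeftmostDesc T s b → InV n s → Desc T b s
  leftmost-desc lm-here                 is = desc-refl is
  leftmost-desc (lm-step (ch , _) rest) _  =
    desc-trans (leftmost-desc rest (proj₁ ch)) (child-desc ch)

  leftmost-path-split : ∀ {s b x} → LeftmostDesc T s b → InV n s → s ≤ x → x < b →
    ∃₂ λ t cl → Desc T t s × LeftChild T cl t × Desc T b cl × t ≤ x × x < cl
  leftmost-path-split lm-here _ s≤x x<s = ⊥-elim (<⇒≱ x<s s≤x)
  leftmost-path-split {x = x} (lm-step {c = c} lc rest) is s≤x x<b with c ≤? x
  ... | no c≰x = _ , c , desc-refl is , lc , leftmost-desc rest (proj₁ (proj₁ lc)) , s≤x , ≰⇒> c≰x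
  ... | yes c≤x with leftmost-path-split rest (proj₁ (proj₁ lc)) c≤x x<b
  ...   | t , cl , dtc , rest′ = t , cl , desc-trans dtc (child-desc (proj₁ lc)) , rest′

  nmin-exists : ∀ {v y} → Adj G v y → ∃ λ m → Nmin T v m × m ≤ y
  nmin-exists {v} {y} adj with least-witness (adj-dec G v) (suc y) (y , n<1+n y , adj)
  ... | m , adj-m , least = m , (adj-m , λ _ → least) , least adj

  children-split : ∀ v → (∃ λ c → SecondChild T c v) ⊎ AtMostOneChild T v
  children-split v with anyUpTo? (λ c → child? c v) (suc n)
  ... | no ∄ = inj₂ λ c _ ch _ → ⊥-elim (∄ (c , inV-< (proj₁ ch) , ch))
  ... | yes ∃c with greatest-witness (λ c → child? c v) (suc n) ∃c
  ...   | g , _ , chg , g-max with anyUpTo? (λ c → child? c v) g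
  ...     | no ∄ = inj₂ λ _ _ ch ch′ → trans (≡g ch) (sym (≡g ch′))
    where
    ≡g : ∀ {c} → Child T c v → c ≡ g
    ≡g ch = ≤-antisym (g-max (inV-< (proj₁ ch)) ch) (≮⇒≥ λ c<g → ∄ (_ , c<g , ch))
  ...     | yes ∃c′ with greatest-witness (λ c → child? c v) g ∃c′
  ...       | s , s<g , chs , s-max =
    inj₁ (s , chs , (g , chg , s<g) , λ _ _ ch s<c ch′ s<c′ → trans (≡g ch s<c) (sym (≡g ch′ s<c′)))
    where
    ≡g : ∀ {c} → Child T c v → s < c → c ≡ g
    ≡g ch s<c = ≤-antisym (g-max (inV-< (proj₁ ch)) ch) (≮⇒≥ λ c<g → <⇒≱ s<c (s-max c<g ch))

  second-child-≥ : ∀ {v cl s c} → LeftChild T cl v → SecondChild T s v →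
                   Child T c v → c < cl → c ≤ s
  second-child-≥ (chcl , _) (_ , _ , unique) chc c<cl =
    ≮⇒≥ λ s<c → <⇒≢ c<cl (unique _ _ chc s<c chcl (<-trans s<c c<cl))

  witn-≥ : ∀ {a v w} → (∀ {m} → Adj G v m → a ≤ m) →
           (∀ {c l} → SecondChild T c v → Lwpt1 T c l → a ≤ l) → Witn T v w → a ≤ w
  witn-≥ neighbour _      (_ , (adj , _) , inj₂ (_ , refl))              = neighbour adj
  witn-≥ neighbour second (_ , (adj , _) , inj₁ (_ , sc , _ , L , refl)) =
    ⊓-glb (neighbour adj) (second sc L)

  module _ (intervals : DescendantIntervals) where

    desc-≥ : ∀ {x y} → Desc T x y → y ≤ x
    desc-≥ {x} {y} dxy = proj₁ (proj₁ (proj₂ (intervals y (desc-inV dxy)) x (proj₁ dxy)) dxy)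

    desc-antisym : ∀ {x y} → Desc T x y → Desc T y x → x ≡ y
    desc-antisym dxy dyx = ≤-antisym (desc-≥ dyx) (desc-≥ dxy)

    desc-between : ∀ {x y z} → Desc T x y → y ≤ z → z ≤ x → Desc T z y
    desc-between {x} {y} {z} dxy y≤z z≤x with intervals y (desc-inV dxy)
    ... | _ , interval =
      proj₂ (interval z iz) (y≤z , ≤-<-trans z≤x (proj₂ (proj₁ (interval x (proj₁ dxy)) dxy)))
      where
      iz : InV n z
      iz = ≤-trans (proj₁ (desc-inV dxy)) y≤z , ≤-trans z≤x (proj₂ (proj₁ dxy))

    ancestors-ordered : ∀ {x y z} → Desc T x y → Desc T x z → y ≤ z → Desc T z y
    ancestors-ordered dxy dxz y≤z = desc-between dxy y≤z (desc-≥ dxz)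

    child-< : ∀ {c v} → Child T c v → v < c
    child-< ch = ≤∧≢⇒< (desc-≥ (child-desc ch)) (≢-sym (child-≢ ch))

    properAnc⇒< : ∀ {y x} → ProperAnc T y x → y < x
    properAnc⇒< (dxy , y≢x) = ≤∧≢⇒< (desc-≥ dxy) y≢x

    between-child-and-parent : ∀ {c p v} → Child T c p → Desc T c v → Desc T v p → v ≡ p ⊎ v ≡ c
    between-child-and-parent {c} {v = v} chc dcv dvp with v ≟ c
    ... | yes v≡c = inj₂ v≡c
    ... | no v≢c =
      inj₁ (desc-antisym dvp (subst (λ z → Desc T z v) (proj₂ (proj₂ chc)) (desc-par dcv v≢c)))

    desc-child-on-branch : ∀ {c s b v} → Child T c s → Desc T b c →
                           Desc T b v → Desc T v s → v ≢ s → Desc T v c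
    desc-child-on-branch {c} {v = v} chc dbc dbv dvs v≢s with ≤-total c v
    ... | inj₁ c≤v = ancestors-ordered dbc dbv c≤v
    ... | inj₂ v≤c with between-child-and-parent chc (ancestors-ordered dbv dbc v≤c) dvs
    ...   | inj₁ v≡s = ⊥-elim (v≢s v≡s)
    ...   | inj₂ refl = desc-refl (proj₁ chc)

    sibling-subtrees-ordered : ∀ {p j k x y} → Child T j p → Child T k p → j < k →
                               Desc T x j → Desc T y k → x < y
    sibling-subtrees-ordered {j = j} {k} {x} {y} chj chk j<k dxj dyk with intervals j (proj₁ chj)
    ... | m , interval = <-≤-trans (proj₂ (proj₁ (interval x (proj₁ dxj)) dxj)) (≮⇒≥ y∉subtree)
      where
      dyj : y < j + m → Desc T y j
      dyj y<j+m = proj₂ (interval y (proj₁ dyk)) (<⇒≤ (<-≤-trans j<k (desc-≥ dyk)) , y<j+m)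
      y∉subtree : ¬ (y < j + m)
      y∉subtree y<j+m
        with between-child-and-parent chk (ancestors-ordered (dyj y<j+m) dyk (<⇒≤ j<k))
                                          (child-desc chj)
      ... | inj₁ j≡p = child-≢ chj j≡p
      ... | inj₂ j≡k = <⇒≢ j<k j≡k

    back-edge : ∀ {x y} → Adj G x y → Desc T x y → y ≢ par T x → BackEdge T x y
    back-edge {x} adj dxy y≢px =
      adj , dxy , (λ (_ , px≡y) → y≢px (sym px≡y)) ,
      λ (_ , py≡x) →
        adj-irr G (subst (Adj G x) (sym (desc-antisym dxy (desc-inV dxy , 1 , py≡x))) adj)

    desc? : ∀ x y → Dec (Desc T x y)
    desc? x y with inV? y
    ... | no ¬iy = no (¬iy ∘ desc-inV)
    ... | yes iy with intervals y iy | inV? x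
    ...   | _ , _        | no ¬ix = no (¬ix ∘ proj₁)
    ...   | m , interval | yes ix =
      map′ (proj₂ (interval x ix)) (proj₁ (interval x ix)) ((y ≤? x) ×-dec (x <? y + m))

    inL? : ∀ v u → Dec (InL T v u)
    inL? v u =
      (desc? v u ×-dec ¬? (u ≟ v)) ×-dec
      map′ (λ (d , _ , q) → d , q) (λ (d , q) → d , inV-< (proj₁ (proj₁ q)) , q)
           (anyUpTo? (λ d → desc? d v ×-dec adj-dec G d u) (suc n))

    inL-< : ∀ {v u} → InL T v u → u < suc n
    inL-< ((dvu , _) , _) = inV-< (desc-inV dvu)

    -- L(v) consists of ancestors of v, which are numbered in order of depth, so lwpt₁(v) and
    -- lwpt₂(v) are its two smallest elements.
    lwpt₁-exists : ∀ v → ∃ (Lwpt1 T v)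
    lwpt₁-exists v with least-or-none (inL? v) (suc n) inL-<
    ... | inj₁ ∅ = v , inj₂ (∅ , refl)
    ... | inj₂ (l , l∈L , least) = l , inj₁ (l∈L , λ _ u∈L u↑l → <⇒≱ (properAnc⇒< u↑l) (least u∈L))

    lwpt₂-exists : ∀ v → ∃ (Lwpt2 T v)
    lwpt₂-exists v with least-or-none (inL? v) (suc n) inL-<
    ... | inj₁ ∅ = v , inj₂ ((λ u _ u∈L _ → ⊥-elim (∅ u u∈L)) , refl)
    ... | inj₂ (l₁ , l₁∈L , l₁-least)
      with least-or-none (λ u → inL? v u ×-dec (l₁ <? u)) (suc n) (inL-< ∘ proj₁)
    ...   | inj₁ ∅ = v , inj₂ ((λ _ _ u∈L u′∈L → trans (≡l₁ u∈L) (sym (≡l₁ u′∈L))) , refl)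
      where
      ≡l₁ : ∀ {u} → InL T v u → u ≡ l₁
      ≡l₁ u∈L = ≤-antisym (≮⇒≥ λ l₁<u → ∅ _ (u∈L , l₁<u)) (l₁-least u∈L)
    ...   | inj₂ (l₂ , (l₂∈L , l₁<l₂) , l₂-least) =
      l₂ , inj₁ (l₂∈L , (l₁ , l₁∈L , l₁↑l₂) ,
                 λ _ _ u∈L u↑l₂ u′∈L u′↑l₂ → trans (≡l₁ u∈L u↑l₂) (sym (≡l₁ u′∈L u′↑l₂)))
      where
      l₁↑l₂ : ProperAnc T l₁ l₂
      l₁↑l₂ = ancestors-ordered (proj₁ (proj₁ l₁∈L)) (proj₁ (proj₁ l₂∈L)) (<⇒≤ l₁<l₂) , <⇒≢ l₁<l₂
      ≡l₁ : ∀ {u} → InL T v u → ProperAnc T u l₂ → u ≡ l₁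
      ≡l₁ u∈L u↑l₂ =
        ≤-antisym (≮⇒≥ λ l₁<u → <⇒≱ (properAnc⇒< u↑l₂) (l₂-least (u∈L , l₁<u))) (l₁-least u∈L)

    lwpt₁-≤ : ∀ {v u l} → InL T v u → Lwpt1 T v l → l ≤ u
    lwpt₁-≤ u∈L (inj₂ (∅ , _)) = ⊥-elim (∅ _ u∈L)
    lwpt₁-≤ u∈L (inj₁ (l∈L , minimal)) =
      ≮⇒≥ λ u<l → minimal _ u∈L
        (ancestors-ordered (proj₁ (proj₁ u∈L)) (proj₁ (proj₁ l∈L)) (<⇒≤ u<l) , <⇒≢ u<l)

    witn-≤-neighbour : ∀ {v y} → Adj G v y → ∃ λ w → Witn T v w × w ≤ y
    witn-≤-neighbour {v} adj with nmin-exists adj | children-split v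
    ... | m , nm , m≤y | inj₂ atMostOne = m , (m , nm , inj₂ (atMostOne , refl)) , m≤y
    ... | m , nm , m≤y | inj₁ (c , sc) with lwpt₁-exists c
    ...   | l , L = m ⊓ l , (m , nm , inj₁ (c , sc , l , L , refl)) , ≤-trans (m⊓n≤m m l) m≤y

    witn-≤-lwpt₁ : ∀ {v c l} → SecondChild T c v → Lwpt1 T c l → ∃ λ w → Witn T v w × w ≤ l
    witn-≤-lwpt₁ {c = c} {l} sc L with nmin-exists (child-adj (proj₁ sc))
    ... | m , nm , _ = m ⊓ l , (m , nm , inj₁ (c , sc , l , L , refl)) , m⊓n≤n m l

    leftmost-path-through : ∀ {s b v} → LeftmostDesc T s b → InV n s →
                            Desc T b v → Desc T v s → v ≢ b →
                            ∃ λ cl → LeftChild T cl v × Desc T b cl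
    leftmost-path-through lm-here _ dbv dvs v≢b = ⊥-elim (v≢b (desc-antisym dvs dbv))
    leftmost-path-through {s} {v = v} (lm-step {c = c} lc rest) _ dbv dvs v≢b with v ≟ s
    ... | yes refl = c , lc , leftmost-desc rest (proj₁ (proj₁ lc))
    ... | no v≢s =
      leftmost-path-through rest (proj₁ (proj₁ lc)) dbv
        (desc-child-on-branch (proj₁ lc) (leftmost-desc rest (proj₁ (proj₁ lc))) dbv dvs v≢s) v≢b

    stable-≤-neighbour : ∀ {a a' b v m} → Normal T → Stable T a a' b →
                         Desc T v a → a ≢ v → a' ≤ v → v < b → Adj G v m → a ≤ m
    stable-≤-neighbour {v = v} {m} normal stable dva a≢v a'≤v v<b adj with normal v m adj
    ... | inj₂ dmv = ≤-trans (desc-≥ dva) (desc-≥ dmv)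
    ... | inj₁ dvm with m ≟ par T v
    ...   | yes refl = desc-≥ (desc-par dva a≢v)
    ...   | no m≢pv = stable v m (back-edge adj dvm m≢pv) a'≤v v<b

    stable-≤-lwpt₁ : ∀ {a a' b v s l} → Stable T a a' b → Desc T v a → Desc T v a' →
                     (∃ λ cl → LeftChild T cl v × Desc T b cl) →
                     SecondChild T s v → Lwpt1 T s l → a ≤ l
    stable-≤-lwpt₁ _ dva _ _ (chs , _) (inj₂ (_ , refl)) = ≤-trans (desc-≥ dva) (<⇒≤ (child-< chs))
    stable-≤-lwpt₁ {a' = a'} {b} {v} {s} {l} stable dva dva' (cl , (chcl , cl-max) , dbcl)
                   (chs , (c , chc , s<c) , _) (inj₁ (((dsl , l≢s) , d , dds , adj) , _)) with l ≟ v
    ... | yes refl = desc-≥ dva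
    ... | no l≢v = stable d l (back-edge adj (desc-trans dds dsl) l≢pd) a'≤d d<b
      where
      l≢pd : l ≢ par T d
      l≢pd l≡pd with d ≟ s
      ... | yes refl = l≢v (trans l≡pd (proj₂ (proj₂ chs)))
      ... | no d≢s =
        l≢s (desc-antisym (subst (λ z → Desc T z s) (sym l≡pd) (desc-par dds (≢-sym d≢s))) dsl)
      a'≤d : a' ≤ d
      a'≤d = desc-≥ (desc-trans dds (desc-trans (child-desc chs) dva'))
      d<b : d < b
      d<b = sibling-subtrees-ordered chs chcl (<-≤-trans s<c (cl-max c chc)) dds dbcl

    stable⇒witnsAtLeast : ∀ {a a' b} → Normal T → LeftmostPath T a a' b →
                              Stable T a a' b → WitnsAtLeast a b
    stable⇒witnsAtLeast {a' = a'} normal (cha , lm) stable v (dbv , dva , v≢a , v≢b) _ =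
      witn-≥ (stable-≤-neighbour normal stable dva (≢-sym v≢a) (desc-≥ dva')
                                 (≤∧≢⇒< (desc-≥ dbv) v≢b))
             (stable-≤-lwpt₁ stable dva dva' (leftmost-path-through lm (proj₁ cha) dbv dva' v≢b))
      where
      dva' : Desc T v a'
      dva' = desc-child-on-branch cha (leftmost-desc lm (proj₁ cha)) dbv dva v≢a

    module _ (siblings : SiblingsOrderedByLowpoints) where

      lwpt₁-antitone : ∀ {p j k l m} → Child T j p → Child T k p → j < k →
                       Lwpt1 T j l → Lwpt1 T k m → m ≤ l
      lwpt₁-antitone {p} {j} {k} chj chk j<k Lj Lk
        with siblings p j k chj chk j<k _ _ _ _
                      Lj (proj₂ (lwpt₂-exists j)) Lk (proj₂ (lwpt₂-exists k))
      ... | inj₁ m<l = <⇒≤ m<l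
      ... | inj₂ (l≡m , _) = ≤-reflexive (sym l≡m)

      lwpt₁-≤-sibling : ∀ {p j k u l} → Child T j p → Child T k p → j ≤ k →
                        InL T j u → Lwpt1 T k l → l ≤ u
      lwpt₁-≤-sibling {j = j} chj chk j≤k u∈L Lk with m≤n⇒m<n∨m≡n j≤k
      ... | inj₂ refl = lwpt₁-≤ u∈L Lk
      ... | inj₁ j<k =
        let _ , Lj = lwpt₁-exists j
        in  ≤-trans (lwpt₁-antitone chj chk j<k Lj Lk) (lwpt₁-≤ u∈L Lj)

      witn-≤-via-child : ∀ {t cl c y} → LeftChild T cl t → Child T c t → c < cl → InL T c y →
                         ∃ λ w → Witn T t w × w ≤ y
      witn-≤-via-child {t} lc chc c<cl y∈L with children-split t
      ... | inj₂ atMostOne = ⊥-elim (<⇒≢ c<cl (atMostOne _ _ chc (proj₁ lc)))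
      ... | inj₁ (s , sc) with lwpt₁-exists s
      ...   | l , L with witn-≤-lwpt₁ sc L
      ...     | w , W , w≤l =
        w , W , ≤-trans w≤l (lwpt₁-≤-sibling chc (proj₁ sc) (second-child-≥ lc sc chc c<cl) y∈L L)

      witn-≤-back-edge : ∀ {t cl x y} → LeftChild T cl t → Desc T x t → x < cl →
                         Adj G x y → Desc T x y → y ≤ t → ∃ λ w → Witn T t w × w ≤ y
      witn-≤-back-edge {t} {cl} {x} {y} lc dxt x<cl adj dxy y≤t with x ≟ t
      ... | yes refl = witn-≤-neighbour adj
      ... | no x≢t with child-towards dxt x≢t
      ...   | c , chc , dxc = witn-≤-via-child lc chc c<cl ((dcy , <⇒≢ y<c) , x , dxc , adj)
        where
        y<c : y < c
        y<c = ≤-<-trans y≤t (child-< chc)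
        dcy : Desc T c y
        dcy = ancestors-ordered dxy dxc (<⇒≤ y<c)
        c<cl : c < cl
        c<cl = ≤∧≢⇒< (proj₂ lc c chc) λ c≡cl → <⇒≱ x<cl (desc-≥ (subst (Desc T x) c≡cl dxc))

      low-back-edge-witn : ∀ {a a' b x y} → LeftmostPath T a a' b →
                           BackEdge T x y → a' ≤ x → x < b → y < a →
                           ∃ λ t → Internal T a b t × ∃ λ w → Witn T t w × w ≤ y
      low-back-edge-witn {a} {b = b} {x} (cha , lm) (adj , dxy , _) a'≤x x<b y<a
        with leftmost-path-split lm (proj₁ cha) a'≤x x<b
      ... | t , cl , dta' , lc , dbcl , t≤x , x<cl =
        t , internal , witn-≤-back-edge lc dxt x<cl adj dxy (<⇒≤ (<-trans y<a a<t))
        where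
        a<t : a < t
        a<t = <-≤-trans (child-< cha) (desc-≥ dta')
        t<b : t < b
        t<b = <-≤-trans (child-< (proj₁ lc)) (desc-≥ dbcl)
        dxt : Desc T x t
        dxt = desc-between (child-desc (proj₁ lc)) t≤x (<⇒≤ x<cl)
        internal : Internal T a b t
        internal = desc-trans dbcl (child-desc (proj₁ lc)) , desc-trans dta' (child-desc cha) ,
                   (λ t≡a → <⇒≢ a<t (sym t≡a)) , <⇒≢ t<b

      witnsAtLeast⇒stable : ∀ {a a' b} → LeftmostPath T a a' b →
                                WitnsAtLeast a b → Stable T a a' b
      witnsAtLeast⇒stable {a} path bounded x y be a'≤x x<b with a ≤? y
      ... | yes a≤y = a≤y
      ... | no a≰y with low-back-edge-witn path be a'≤x x<b (≰⇒> a≰y)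
      ...   | t , internal , w , W , w≤y = ≤-trans (bounded t internal w W) w≤y

lemma3p6 : ∀ {n} (G : Graph n) (T : SpanningTree G) → Normal T → Compatible T →
    ∀ a a' b → LeftmostPath T a a' b → a < b →
    (Stable T a a' b ⇔ (∀ v → Internal T a b v → ∀ w → Witn T v w → a ≤ w))
lemma3p6 G T normal (intervals , siblings) a a' b path _ =
  mk⇔ (stable⇒witnsAtLeast T intervals normal path)
      (witnsAtLeast⇒stable T intervals siblings path)
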